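{- For $n\ge 0$ let $\mathfrak{d}^e_n$ and $\mathfrak{d}^o_n$ be the numbers of even and odd parity alternating derangements (PADs) of $[n]$, and let $d^e_m$, $d^o_m$ be the numbers of even and odd derangements of $[m]$, with $d^e_0=1$, $d^e_1=0$, $d^o_0=0$, $d^o_1=0$. Then for every $n\ge 0$, \[ \mathfrak{d}^e_n=d^e_{\lfloor n/2\rfloor}d^e_{\lceil n/2\rceil}+d^o_{\lfloor n/2\rfloor}d^o_{\lceil n/2\rceil},\qquad \mathfrak{d}^o_n=d^e_{\lfloor n/2\rfloor}d^o_{\lceil n/2\rceil}+d^e_{\lceil n/2\rceil}d^o_{\lfloor n/2\rfloor}. \]
   Context: A permutation $\sigma$ of $[n]=\{1,\dots,n\}$, in one-line notation, is a PAP if $\sigma(i)\equiv i\pmod 2$ for all $i$ (entries alternate in parity, first entry odd); a PAD is a PAP that is a derangement ($\sigma(i)\ne i$ for all $i$). A permutation of $[m]$ is even or odd according to its sign $(-1)^{m-c}$, where $c$ is its number of cycles (fixed points included). The empty permutation is an even derangement and an even PAD. -}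

module Defs where

open import Data.Nat using (ℕ; zero; suc; _∸_; _≤_; _%_)
open import Data.Nat.Properties using (_≤?_)
import Data.Nat.Properties as ℕP
open import Data.Fin using (Fin; toℕ)
open import Data.Fin.Properties using (all?) renaming (_≟_ to _≟F_)
open import Data.List using (List; []; _∷_; [_]; map; concatMap; filter; length; allFin)
open import Data.Vec using (Vec; lookup) renaming ([] to []ᵥ; _∷_ to _∷ᵥ_)
open import Data.Product using (_×_)
open import Relation.Binary.PropositionalEquality using (_≡_; _≢_)
open import Relation.Nullary using (Dec; yes; no; ¬_)
open import Relation.Nullary.Decidable using (_×-dec_; _→-dec_; ¬?)

words : (n k : ℕ) → List (Vec (Fin n) k)
words n zero    = [ []ᵥ ]
words n (suc k) = concatMap (λ v → map (_∷ᵥ v) (allFin n)) (words n k)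

-- A word of length n over Fin n, read in one-line notation
-- (position i ↦ entry lookup σ i); points of [n] are encoded as Fin n,
-- i.e. point j+1 is encoded by j.
IsPerm : ∀ {n} → Vec (Fin n) n → Set
IsPerm {n} σ = (i j : Fin n) → lookup σ i ≡ lookup σ j → i ≡ j

IsDerangement : ∀ {n} → Vec (Fin n) n → Set
IsDerangement {n} σ = (i : Fin n) → lookup σ i ≢ i

-- σ(i) ≡ i (mod 2); shifting both by one (1-based points) preserves this.
IsParityAlternating : ∀ {n} → Vec (Fin n) n → Set
IsParityAlternating {n} σ = (i : Fin n) → toℕ (lookup σ i) % 2 ≡ toℕ i % 2

iter : ∀ {n} → Vec (Fin n) n → ℕ → Fin n → Fin n
iter σ zero    i = i
iter σ (suc k) i = lookup σ (iter σ k i)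

-- i is the least element of its cycle: σ^k(i) ≥ i for every k < n
-- (every cycle has length ≤ n, so this covers the whole cycle).
IsCycleMin : ∀ {n} → Vec (Fin n) n → Fin n → Set
IsCycleMin {n} σ i = (k : Fin n) → toℕ i ≤ toℕ (iter σ (toℕ k) i)

isCycleMin? : ∀ {n} (σ : Vec (Fin n) n) (i : Fin n) → Dec (IsCycleMin σ i)
isCycleMin? σ i = all? (λ k → toℕ i ≤? toℕ (iter σ (toℕ k) i))

-- number of cycles (fixed points included) = number of cycle minima
cycles : ∀ {n} → Vec (Fin n) n → ℕ
cycles {n} σ = length (filter (isCycleMin? σ) (allFin n))

-- sign (-1)^(n - c): even iff n - c is even
IsEven : ∀ {n} → Vec (Fin n) n → Set
IsEven {n} σ = (n ∸ cycles σ) % 2 ≡ 0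

IsOdd : ∀ {n} → Vec (Fin n) n → Set
IsOdd σ = ¬ IsEven σ

isPerm? : ∀ {n} (σ : Vec (Fin n) n) → Dec (IsPerm σ)
isPerm? σ = all? (λ i → all? (λ j → (lookup σ i ≟F lookup σ j) →-dec (i ≟F j)))

isDerangement? : ∀ {n} (σ : Vec (Fin n) n) → Dec (IsDerangement σ)
isDerangement? σ = all? (λ i → ¬? (lookup σ i ≟F i))

isParityAlternating? : ∀ {n} (σ : Vec (Fin n) n) → Dec (IsParityAlternating σ)
isParityAlternating? σ = all? (λ i → toℕ (lookup σ i) % 2 ℕP.≟ toℕ i % 2)

isEven? : ∀ {n} (σ : Vec (Fin n) n) → Dec (IsEven σ)
isEven? {n} σ = (n ∸ cycles σ) % 2 ℕP.≟ 0

isOdd? : ∀ {n} (σ : Vec (Fin n) n) → Dec (IsOdd σ)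
isOdd? σ = ¬? (isEven? σ)

evenDerangements oddDerangements : ℕ → ℕ
evenDerangements m =
  length (filter (λ σ → isPerm? σ ×-dec isDerangement? σ ×-dec isEven? σ) (words m m))
oddDerangements m =
  length (filter (λ σ → isPerm? σ ×-dec isDerangement? σ ×-dec isOdd? σ) (words m m))

evenPADs oddPADs : ℕ → ℕ
evenPADs n =
  length (filter (λ σ → isPerm? σ ×-dec isParityAlternating? σ ×-dec isDerangement? σ ×-dec isEven? σ) (words n n))
oddPADs n =
  length (filter (λ σ → isPerm? σ ×-dec isParityAlternating? σ ×-dec isDerangement? σ ×-dec isOdd? σ) (words n n))

module Submission where

-- A parity alternating σ maps the odd points of [n] to odd points and the even points to even
-- points, so it is the interleaving of a map α on the ⌈n/2⌉ odd points and a map β on the ⌊n/2⌋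
-- even points; σ is a permutation, resp. a derangement, iff α and β both are. Relabelling the odd
-- points 2j+1 ↦ j+1 and the even points 2j ↦ j is monotone, so the cycle minima of σ are exactly the
-- relabelled cycle minima of α and β, whence n − c(σ) = (⌈n/2⌉ − c(α)) + (⌊n/2⌋ − c(β)). Thus σ is
-- even iff α and β have the same sign, and counting the pairs (β, α) by sign gives both formulas.

open import Defs
open import Data.Nat using (ℕ; zero; suc; _+_; _*_; _∸_; _≤_; _<_; z≤n; s≤s; _%_; ⌊_/2⌋; ⌈_/2⌉)
open import Data.Nat.Properties
  using (_<?_; ≤-antisym; ≤-trans; ≤-pred; ≤-reflexive; n<1+n; ≮⇒≥; +-suc; +-comm; *-comm; m∸n+n≡m; +-monoʳ-<;
         *-monoˡ-≤; *-cancelʳ-≤; ∸-+-assoc; +-∸-comm; +-∸-assoc; ⌊n/2⌋+⌈n/2⌉≡n)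
open import Data.Nat.DivMod using (m*n%n≡0; [m+kn]%n≡m%n; m%n<n; %-distribˡ-+)
open import Data.Nat.Induction using (<-rec)
open import Data.Fin using (Fin; zero; suc; toℕ; fromℕ<) renaming (_≤_ to _≤ᶠ_)
open import Data.Fin.Properties using (toℕ-fromℕ<; toℕ<n; pigeonhole)
open import Data.List
  using (List; []; _∷_; _++_; map; concatMap; filter; length; allFin; cartesianProduct; cartesianProductWith)
open import Data.List.Properties
  using (length-++; length-filter; length-tabulate; length-removeAt′; filter-++; filter-≐; filter-none)
open import Data.List.Membership.Propositional using (_∈_; _─_)
open import Data.List.Membership.Propositional.Properties
  using (∈-filter⁺; ∈-filter⁻; ∈-map⁺; ∈-map⁻; ∈-++⁺ˡ; ∈-++⁺ʳ; ∈-allFin;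
         ∈-cartesianProduct⁺; ∈-cartesianProductWith⁺)
open import Data.List.Relation.Unary.Any using (here; there; index)
import Data.List.Relation.Unary.All as All
open import Data.List.Relation.Unary.AllPairs using ([]; _∷_)
open import Data.List.Relation.Unary.Unique.Propositional using (Unique)
import Data.List.Relation.Unary.Unique.Propositional.Properties as Unique
open import Data.Vec using (Vec; lookup; tabulate) renaming ([] to []ᵥ; _∷_ to _∷ᵥ_)
open import Data.Vec.Properties using (∷-injective; lookup∘tabulate; tabulate∘lookup; tabulate-cong)
open import Data.Product using (_×_; _,_; proj₁; proj₂; ∃-syntax)
open import Data.Sum using (_⊎_; inj₁; inj₂; [_,_]′; fromInj₁; fromInj₂)
import Data.Sum as Sum
open import Data.Sum.Properties using (inj₁-injective; inj₂-injective)
open import Function using (_∘_; id; _⇔_; mk⇔; Equivalence)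
open import Relation.Nullary using (yes; no; ¬_; contradiction)
open import Relation.Nullary.Decidable using (_×-dec_; _⊎-dec_)
open import Relation.Unary using (Decidable)
open import Relation.Binary.PropositionalEquality
  using (_≡_; _≢_; refl; sym; trans; cong; cong₂; subst; subst₂; module ≡-Reasoning)
open ≡-Reasoning

Endo : ℕ → Set
Endo m = Vec (Fin m) m

[m+n]∸[o+p]≡[m∸o]+[n∸p] : ∀ {m n o p} → o ≤ m → p ≤ n → (m + n) ∸ (o + p) ≡ (m ∸ o) + (n ∸ p)
[m+n]∸[o+p]≡[m∸o]+[n∸p] {m} {n} {o} {p} o≤m p≤n = begin
  (m + n) ∸ (o + p)   ≡⟨ sym (∸-+-assoc (m + n) o p) ⟩
  (m + n) ∸ o ∸ p     ≡⟨ cong (_∸ p) (+-∸-comm n o≤m) ⟩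
  (m ∸ o + n) ∸ p     ≡⟨ +-∸-assoc (m ∸ o) p≤n ⟩
  (m ∸ o) + (n ∸ p)   ∎

+-%2≡0⇔ : ∀ x y → (x + y) % 2 ≡ 0 ⇔ ((x % 2 ≡ 0 × y % 2 ≡ 0) ⊎ (x % 2 ≢ 0 × y % 2 ≢ 0))
+-%2≡0⇔ x y rewrite %-distribˡ-+ x y 2 ⦃ _ ⦄ with x % 2 | m%n<n x 2 | y % 2 | m%n<n y 2
... | 0 | _ | 0 | _ = mk⇔ (λ _ → inj₁ (refl , refl)) (λ _ → refl)
... | 0 | _ | 1 | _ = mk⇔ (λ ()) [ (λ ()) ∘ proj₂ , contradiction refl ∘ proj₁ ]′
... | 1 | _ | 0 | _ = mk⇔ (λ ()) [ (λ ()) ∘ proj₁ , contradiction refl ∘ proj₂ ]′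
... | 1 | _ | 1 | _ = mk⇔ (λ _ → inj₂ ((λ ()) , (λ ()))) (λ _ → refl)
... | suc (suc _) | s≤s (s≤s ()) | _ | _
... | _ | _ | suc (suc _) | s≤s (s≤s ())

+-%2≢0⇔ : ∀ x y → (x + y) % 2 ≢ 0 ⇔ ((x % 2 ≡ 0 × y % 2 ≢ 0) ⊎ (x % 2 ≢ 0 × y % 2 ≡ 0))
+-%2≢0⇔ x y rewrite %-distribˡ-+ x y 2 ⦃ _ ⦄ with x % 2 | m%n<n x 2 | y % 2 | m%n<n y 2
... | 0 | _ | 0 | _ = mk⇔ (contradiction refl) [ contradiction refl ∘ proj₂ , contradiction refl ∘ proj₁ ]′
... | 0 | _ | 1 | _ = mk⇔ (λ _ → inj₁ (refl , (λ ()))) (λ _ ())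
... | 1 | _ | 0 | _ = mk⇔ (λ _ → inj₂ ((λ ()) , refl)) (λ _ ())
... | 1 | _ | 1 | _ = mk⇔ (contradiction refl) [ (λ ()) ∘ proj₁ , (λ ()) ∘ proj₂ ]′
... | suc (suc _) | s≤s (s≤s ()) | _ | _
... | _ | _ | suc (suc _) | s≤s (s≤s ())

count : {A : Set} {P : A → Set} → Decidable P → List A → ℕ
count P? xs = length (filter P? xs)

record Enumeration (A : Set) : Set where
  field
    elements : List A
    unique   : Unique elements
    complete : ∀ x → x ∈ elements
open Enumeration

∈-─⁺ : {A : Set} {x y : A} {xs : List A} (x∈xs : x ∈ xs) → y ∈ xs → y ≢ x → y ∈ xs ─ x∈xs
∈-─⁺ (here refl)  (here refl)  y≢x = contradiction refl y≢x
∈-─⁺ (here refl)  (there y∈xs) _   = y∈xs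
∈-─⁺ (there _)    (here refl)  _   = here refl
∈-─⁺ (there x∈xs) (there y∈xs) y≢x = there (∈-─⁺ x∈xs y∈xs y≢x)

length-≤-injection : {A B : Set} (f : A → B) {xs : List A} {ys : List B} → Unique xs →
  (∀ {x y} → x ∈ xs → y ∈ xs → f x ≡ f y → x ≡ y) → (∀ {x} → x ∈ xs → f x ∈ ys) →
  length xs ≤ length ys
length-≤-injection f {[]} _ _ _ = z≤n
length-≤-injection f {x ∷ xs} {ys} (x∉xs ∷ xs!) inj into =
  subst (suc (length xs) ≤_) (sym (length-removeAt′ ys (index fx∈ys)))
    (s≤s (length-≤-injection f xs! (λ p q → inj (there p) (there q)) into′))
  where
  fx∈ys = into (here refl)
  into′ : ∀ {y} → y ∈ xs → f y ∈ ys ─ fx∈ys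
  into′ y∈xs = ∈-─⁺ fx∈ys (into (there y∈xs))
    (λ fy≡fx → All.lookup x∉xs y∈xs (inj (here refl) (there y∈xs) (sym fy≡fx)))

count-≤-injection : {A B : Set} {P : A → Set} {Q : B → Set} (P? : Decidable P) (Q? : Decidable Q)
  (xs : Enumeration A) (ys : Enumeration B) (f : A → B) (g : B → A) →
  (∀ {x} → P x → Q (f x)) → (∀ {x} → P x → g (f x) ≡ x) →
  count P? (elements xs) ≤ count Q? (elements ys)
count-≤-injection {P = P} P? Q? xs ys f g PQ gf = length-≤-injection f (Unique.filter⁺ P? (unique xs))
  (λ x∈ y∈ fx≡fy → trans (sym (gf (holds x∈))) (trans (cong g fx≡fy) (gf (holds y∈))))
  (λ x∈ → ∈-filter⁺ Q? (complete ys _) (PQ (holds x∈)))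
  where
  holds : ∀ {x} → x ∈ filter P? (elements xs) → P x
  holds = proj₂ ∘ ∈-filter⁻ P? {xs = elements xs}

count-bijection : {A B : Set} {P : A → Set} {Q : B → Set} (P? : Decidable P) (Q? : Decidable Q)
  (xs : Enumeration A) (ys : Enumeration B) (f : A → B) (g : B → A) →
  (∀ {x} → P x → Q (f x)) → (∀ {y} → Q y → P (g y)) →
  (∀ {x} → P x → g (f x) ≡ x) → (∀ {y} → Q y → f (g y) ≡ y) →
  count P? (elements xs) ≡ count Q? (elements ys)
count-bijection P? Q? xs ys f g PQ QP gf fg =
  ≤-antisym (count-≤-injection P? Q? xs ys f g PQ gf) (count-≤-injection Q? P? ys xs g f QP fg)

module _ {A : Set} where

  count-⇔ : {P Q : A → Set} (P? : Decidable P) (Q? : Decidable Q) → (∀ x → P x ⇔ Q x) →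
    (xs : List A) → count P? xs ≡ count Q? xs
  count-⇔ P? Q? P⇔Q xs =
    cong length (filter-≐ P? Q? ((λ {x} → Equivalence.to (P⇔Q x)) , (λ {x} → Equivalence.from (P⇔Q x))) xs)

  count-++ : {P : A → Set} (P? : Decidable P) (xs ys : List A) →
    count P? (xs ++ ys) ≡ count P? xs + count P? ys
  count-++ P? xs ys = trans (cong length (filter-++ P? xs ys)) (length-++ (filter P? xs))

  count-⊎ : {P Q : A → Set} (P? : Decidable P) (Q? : Decidable Q) → (∀ {x} → P x → ¬ Q x) →
    (xs : List A) → count (λ x → P? x ⊎-dec Q? x) xs ≡ count P? xs + count Q? xs
  count-⊎ P? Q? P⇒¬Q [] = refl
  count-⊎ P? Q? P⇒¬Q (x ∷ xs) with P? x | Q? x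
  ... | yes px | yes qx = contradiction qx (P⇒¬Q px)
  ... | yes _  | no _   = cong suc (count-⊎ P? Q? P⇒¬Q xs)
  ... | no _   | yes _  = trans (cong suc (count-⊎ P? Q? P⇒¬Q xs)) (sym (+-suc _ _))
  ... | no _   | no _   = count-⊎ P? Q? P⇒¬Q xs

count-map : {A B : Set} {Q : B → Set} (Q? : Decidable Q) (f : A → B) (xs : List A) →
  count Q? (map f xs) ≡ count (Q? ∘ f) xs
count-map Q? f [] = refl
count-map Q? f (x ∷ xs) with Q? (f x)
... | yes _ = cong suc (count-map Q? f xs)
... | no _  = count-map Q? f xs

count-× : {A B : Set} {P : A → Set} {Q : B → Set} (P? : Decidable P) (Q? : Decidable Q) →
  (xs : List A) (ys : List B) →
  count (λ p → P? (proj₁ p) ×-dec Q? (proj₂ p)) (cartesianProduct xs ys) ≡ count P? xs * count Q? ys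
count-× P? Q? [] ys = refl
count-× P? Q? (x ∷ xs) ys = begin
    count R? (map (x ,_) ys ++ cartesianProduct xs ys)
  ≡⟨ count-++ R? (map (x ,_) ys) (cartesianProduct xs ys) ⟩
    count R? (map (x ,_) ys) + count R? (cartesianProduct xs ys)
  ≡⟨ cong₂ _+_ (count-map R? (x ,_) ys) (count-× P? Q? xs ys) ⟩
    count (R? ∘ (x ,_)) ys + count P? xs * count Q? ys
  ≡⟨ row ⟩
    count P? (x ∷ xs) * count Q? ys
  ∎
  where
  R? = λ p → P? (proj₁ p) ×-dec Q? (proj₂ p)
  row : count (R? ∘ (x ,_)) ys + count P? xs * count Q? ys ≡ count P? (x ∷ xs) * count Q? ys
  row with P? x
  ... | yes px = cong (_+ _) (cong length (filter-≐ _ Q? (proj₂ , (px ,_)) ys))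
  ... | no ¬px = cong (_+ _) (cong length (filter-none _ (All.universal (λ _ → ¬px ∘ proj₁) ys)))

count-⊎-× : {A B : Set} {P₁ P₂ : A → Set} {Q₁ Q₂ : B → Set}
  (P₁? : Decidable P₁) (P₂? : Decidable P₂) (Q₁? : Decidable Q₁) (Q₂? : Decidable Q₂) →
  (∀ {x} → P₁ x → ¬ P₂ x) → (xs : List A) (ys : List B) →
  count (λ p → (P₁? (proj₁ p) ×-dec Q₁? (proj₂ p)) ⊎-dec (P₂? (proj₁ p) ×-dec Q₂? (proj₂ p))) (cartesianProduct xs ys)
    ≡ count P₁? xs * count Q₁? ys + count P₂? xs * count Q₂? ys
count-⊎-× P₁? P₂? Q₁? Q₂? P₁⇒¬P₂ xs ys =
  trans (count-⊎ _ _ (λ (p₁ , _) (p₂ , _) → P₁⇒¬P₂ p₁ p₂) (cartesianProduct xs ys))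
        (cong₂ _+_ (count-× P₁? Q₁? xs ys) (count-× P₂? Q₂? xs ys))

allFin-enumeration : ∀ n → Enumeration (Fin n)
allFin-enumeration n = record { elements = allFin n ; unique = Unique.allFin⁺ n ; complete = ∈-allFin }

module _ {A B : Set} (xs : Enumeration A) (ys : Enumeration B) where

  ⊎-enumeration : Enumeration (A ⊎ B)
  ⊎-enumeration = record
    { elements = map inj₁ (elements xs) ++ map inj₂ (elements ys)
    ; unique   = Unique.++⁺ (Unique.map⁺ inj₁-injective (unique xs)) (Unique.map⁺ inj₂-injective (unique ys)) disjoint
    ; complete = λ where
        (inj₁ x) → ∈-++⁺ˡ (∈-map⁺ inj₁ (complete xs x))
        (inj₂ y) → ∈-++⁺ʳ _ (∈-map⁺ inj₂ (complete ys y))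
    }
    where
    disjoint : ∀ {v} → ¬ (v ∈ map inj₁ (elements xs) × v ∈ map inj₂ (elements ys))
    disjoint (v∈₁ , v∈₂) with ∈-map⁻ inj₁ v∈₁ | ∈-map⁻ inj₂ v∈₂
    ... | _ , _ , refl | _ , _ , ()

  ×-enumeration : Enumeration (A × B)
  ×-enumeration = record
    { elements = cartesianProduct (elements xs) (elements ys)
    ; unique   = Unique.cartesianProduct⁺ (unique xs) (unique ys)
    ; complete = λ (x , y) → ∈-cartesianProduct⁺ (complete xs x) (complete ys y)
    }

  count-⊎-enumeration : {P : A ⊎ B → Set} (P? : Decidable P) →
    count P? (elements ⊎-enumeration) ≡ count (P? ∘ inj₁) (elements xs) + count (P? ∘ inj₂) (elements ys)
  count-⊎-enumeration P? = trans (count-++ P? (map inj₁ (elements xs)) _)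
    (cong₂ _+_ (count-map P? inj₁ (elements xs)) (count-map P? inj₂ (elements ys)))

words-as-cartesianProductWith : ∀ n k →
  words n (suc k) ≡ cartesianProductWith (λ v i → i ∷ᵥ v) (words n k) (allFin n)
words-as-cartesianProductWith n k = go (words n k)
  where
  go : ∀ vs → concatMap (λ v → map (_∷ᵥ v) (allFin n)) vs ≡ cartesianProductWith (λ v i → i ∷ᵥ v) vs (allFin n)
  go []       = refl
  go (v ∷ vs) = cong (map (_∷ᵥ v) (allFin n) ++_) (go vs)

words-unique : ∀ n k → Unique (words n k)
words-unique n zero    = All.[] ∷ []
words-unique n (suc k) = subst Unique (sym (words-as-cartesianProductWith n k))
  (Unique.cartesianProductWith⁺ (λ v i → i ∷ᵥ v) (λ eq → let i≡j , v≡w = ∷-injective eq in v≡w , i≡j)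
    (words-unique n k) (Unique.allFin⁺ n))

words-complete : ∀ n k (v : Vec (Fin n) k) → v ∈ words n k
words-complete n zero    []ᵥ       = here refl
words-complete n (suc k) (i ∷ᵥ v) = subst (_ ∈_) (sym (words-as-cartesianProductWith n k))
  (∈-cartesianProductWith⁺ (λ v i → i ∷ᵥ v) (words-complete n k v) (∈-allFin i))

words-enumeration : ∀ n k → Enumeration (Vec (Fin n) k)
words-enumeration n k = record { elements = words n k ; unique = words-unique n k ; complete = words-complete n k }

-- Iterates and cycle minima

module _ {n : ℕ} (σ : Endo n) where

  iter-+ : ∀ p q i → iter σ (p + q) i ≡ iter σ p (iter σ q i)
  iter-+ zero    q i = refl
  iter-+ (suc p) q i = cong (lookup σ) (iter-+ p q i)

  -- Pigeonhole on σ⁰(i), …, σⁿ(i) gives σᵖ(i) = σ^q(i) with p < q ≤ n, which shortens any k ≥ n.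
  iter-within : ∀ i k → ∃[ t ] iter σ k i ≡ iter σ (toℕ t) i
  iter-within i = <-rec _ step
    where
    step : ∀ k → (∀ {j} → j < k → ∃[ t ] iter σ j i ≡ iter σ (toℕ t) i) → ∃[ t ] iter σ k i ≡ iter σ (toℕ t) i
    step k shorter with k <? n
    ... | yes k<n = fromℕ< k<n , cong (λ m → iter σ m i) (sym (toℕ-fromℕ< k<n))
    ... | no k≮n with p , q , p<q , σᵖi≡σ^qi ← pigeonhole (n<1+n n) (λ t → iter σ (toℕ t) i) =
      let q≤k  = ≤-trans (≤-pred (toℕ<n q)) (≮⇒≥ k≮n)
          k′   = (k ∸ toℕ q) + toℕ p
          t , σᵏ′i≡σᵗi = shorter (subst (k′ <_) (m∸n+n≡m q≤k) (+-monoʳ-< (k ∸ toℕ q) p<q))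
      in t , (begin
        iter σ k i                            ≡⟨ cong (λ m → iter σ m i) (sym (m∸n+n≡m q≤k)) ⟩
        iter σ ((k ∸ toℕ q) + toℕ q) i        ≡⟨ iter-+ (k ∸ toℕ q) (toℕ q) i ⟩
        iter σ (k ∸ toℕ q) (iter σ (toℕ q) i) ≡⟨ cong (iter σ (k ∸ toℕ q)) (sym σᵖi≡σ^qi) ⟩
        iter σ (k ∸ toℕ q) (iter σ (toℕ p) i) ≡⟨ sym (iter-+ (k ∸ toℕ q) (toℕ p) i) ⟩
        iter σ k′ i                           ≡⟨ σᵏ′i≡σᵗi ⟩
        iter σ (toℕ t) i                      ∎)

  isCycleMin⇒≤iter : ∀ {i} → IsCycleMin σ i → ∀ k → i ≤ᶠ iter σ k i
  isCycleMin⇒≤iter {i} min k with t , σᵏi≡σᵗi ← iter-within i k =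
    subst (i ≤ᶠ_) (sym σᵏi≡σᵗi) (min t)

  cycles≤ : cycles σ ≤ n
  cycles≤ = ≤-trans (length-filter (isCycleMin? σ) (allFin n)) (≤-reflexive (length-tabulate id))

module _ {m n : ℕ} (σ : Endo n) (τ : Endo m) (h : Fin m → Fin n)
         (h-commutes : ∀ x → lookup σ (h x) ≡ h (lookup τ x)) where

  iter-commute : ∀ k x → iter σ k (h x) ≡ h (iter τ k x)
  iter-commute zero    x = refl
  iter-commute (suc k) x = trans (cong (lookup σ) (iter-commute k x)) (h-commutes _)

  isPerm-restriction : (∀ {x y} → h x ≡ h y → x ≡ y) → IsPerm σ → IsPerm τ
  isPerm-restriction h-inj σ-inj x y τx≡τy =
    h-inj (σ-inj (h x) (h y) (trans (h-commutes x) (trans (cong h τx≡τy) (sym (h-commutes y)))))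

  isDerangement-restriction : IsDerangement σ → IsDerangement τ
  isDerangement-restriction σ-der x τx≡x = σ-der (h x) (trans (h-commutes x) (cong h τx≡x))

  isCycleMin-embedding : (∀ {x y} → x ≤ᶠ y ⇔ h x ≤ᶠ h y) → ∀ x → IsCycleMin σ (h x) ⇔ IsCycleMin τ x
  isCycleMin-embedding h-≤ x = mk⇔
    (λ min k → Equivalence.from h-≤
      (subst (h x ≤ᶠ_) (iter-commute (toℕ k) x) (isCycleMin⇒≤iter σ min (toℕ k))))
    (λ min k → subst (h x ≤ᶠ_) (sym (iter-commute (toℕ k) x))
      (Equivalence.to h-≤ (isCycleMin⇒≤iter τ min (toℕ k))))

-- Splitting Fin n by parity

-- Indices are 0-based: `even` enumerates the positions 1, 3, 5, … of the paper and `odd` the positions 2, 4, ….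
even : ∀ {n} → Fin ⌈ n /2⌉ → Fin n
even {suc n}       zero    = zero
even {suc (suc n)} (suc j) = suc (suc (even j))

odd : ∀ {n} → Fin ⌊ n /2⌋ → Fin n
odd {suc (suc n)} zero    = suc zero
odd {suc (suc n)} (suc j) = suc (suc (odd j))

join : ∀ {n} → Fin ⌈ n /2⌉ ⊎ Fin ⌊ n /2⌋ → Fin n
join = [ even , odd ]′

split : ∀ {n} → Fin n → Fin ⌈ n /2⌉ ⊎ Fin ⌊ n /2⌋
split {suc n}       zero          = inj₁ zero
split {suc (suc n)} (suc zero)    = inj₂ zero
split {suc (suc n)} (suc (suc i)) = Sum.map suc suc (split i)

join-split : ∀ {n} (i : Fin n) → join (split i) ≡ i
join-split {suc n}       zero          = refl
join-split {suc (suc n)} (suc zero)    = refl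
join-split {suc (suc n)} (suc (suc i)) with split i | join-split i
... | inj₁ j | refl = refl
... | inj₂ j | refl = refl

split-join : ∀ {n} (s : Fin ⌈ n /2⌉ ⊎ Fin ⌊ n /2⌋) → split (join s) ≡ s
split-join {suc n}       (inj₁ zero)    = refl
split-join {suc (suc n)} (inj₁ (suc j)) = cong (Sum.map suc suc) (split-join (inj₁ j))
split-join {suc (suc n)} (inj₂ zero)    = refl
split-join {suc (suc n)} (inj₂ (suc j)) = cong (Sum.map suc suc) (split-join (inj₂ j))

toℕ-even : ∀ {n} (j : Fin ⌈ n /2⌉) → toℕ (even j) ≡ toℕ j * 2
toℕ-even {suc n}       zero    = refl
toℕ-even {suc (suc n)} (suc j) = cong (2 +_) (toℕ-even j)

toℕ-odd : ∀ {n} (j : Fin ⌊ n /2⌋) → toℕ (odd j) ≡ 1 + toℕ j * 2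
toℕ-odd {suc (suc n)} zero    = refl
toℕ-odd {suc (suc n)} (suc j) = cong (2 +_) (toℕ-odd j)

even-≤ : ∀ {n} {i j : Fin ⌈ n /2⌉} → i ≤ᶠ j ⇔ even i ≤ᶠ even j
even-≤ {i = i} {j} = mk⇔
  (λ i≤j → subst₂ _≤_ (sym (toℕ-even i)) (sym (toℕ-even j)) (*-monoˡ-≤ 2 i≤j))
  (λ 2i≤2j → *-cancelʳ-≤ (toℕ i) (toℕ j) 2 (subst₂ _≤_ (toℕ-even i) (toℕ-even j) 2i≤2j))

odd-≤ : ∀ {n} {i j : Fin ⌊ n /2⌋} → i ≤ᶠ j ⇔ odd i ≤ᶠ odd j
odd-≤ {i = i} {j} = mk⇔
  (λ i≤j → subst₂ _≤_ (sym (toℕ-odd i)) (sym (toℕ-odd j)) (s≤s (*-monoˡ-≤ 2 i≤j)))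
  (λ 2i+1≤2j+1 → *-cancelʳ-≤ (toℕ i) (toℕ j) 2 (≤-pred (subst₂ _≤_ (toℕ-odd i) (toℕ-odd j) 2i+1≤2j+1)))

even-%2 : ∀ {n} (j : Fin ⌈ n /2⌉) → toℕ (even j) % 2 ≡ 0
even-%2 j = trans (cong (_% 2) (toℕ-even j)) (m*n%n≡0 (toℕ j) 2)

odd-%2 : ∀ {n} (j : Fin ⌊ n /2⌋) → toℕ (odd j) % 2 ≡ 1
odd-%2 j = trans (cong (_% 2) (toℕ-odd j)) ([m+kn]%n≡m%n 1 (toℕ j) 2)

even-fromInj₁-split : ∀ {n} (d : Fin ⌊ n /2⌋ → Fin ⌈ n /2⌉) (x : Fin n) →
  toℕ x % 2 ≡ 0 → even (fromInj₁ d (split x)) ≡ x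
even-fromInj₁-split d x x%2≡0 with split x | join-split x
... | inj₁ j | refl = refl
... | inj₂ j | refl = contradiction (trans (sym x%2≡0) (odd-%2 j)) λ ()

odd-fromInj₂-split : ∀ {n} (d : Fin ⌈ n /2⌉ → Fin ⌊ n /2⌋) (x : Fin n) →
  toℕ x % 2 ≡ 1 → odd (fromInj₂ d (split x)) ≡ x
odd-fromInj₂-split d x x%2≡1 with split x | join-split x
... | inj₁ j | refl = contradiction (trans (sym (even-%2 j)) x%2≡1) λ ()
... | inj₂ j | refl = refl

join-injective : ∀ {n} {s t : Fin ⌈ n /2⌉ ⊎ Fin ⌊ n /2⌋} → join s ≡ join t → s ≡ t
join-injective {s = s} {t} js≡jt = trans (sym (split-join s)) (trans (cong split js≡jt) (split-join t))

split-injective : ∀ {n} {i j : Fin n} → split i ≡ split j → i ≡ j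
split-injective {i = i} {j} si≡sj = trans (sym (join-split i)) (trans (cong join si≡sj) (join-split j))

count-allFin-split : ∀ {n} {P : Fin n → Set} (P? : Decidable P) →
  count P? (allFin n) ≡ count (P? ∘ even) (allFin ⌈ n /2⌉) + count (P? ∘ odd) (allFin ⌊ n /2⌋)
count-allFin-split {n} {P} P? = trans
  (count-bijection P? (P? ∘ join) (allFin-enumeration n) halves split join
    (λ {i} → subst P (sym (join-split i))) id (λ {i} _ → join-split i) (λ {s} _ → split-join s))
  (count-⊎-enumeration (allFin-enumeration _) (allFin-enumeration _) (P? ∘ join))
  where
  halves = ⊎-enumeration (allFin-enumeration ⌈ n /2⌉) (allFin-enumeration ⌊ n /2⌋)

⊎-map-injective : {A B C D : Set} {f : A → C} {g : B → D} →
  (∀ x y → f x ≡ f y → x ≡ y) → (∀ x y → g x ≡ g y → x ≡ y) →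
  ∀ {s t} → Sum.map f g s ≡ Sum.map f g t → s ≡ t
⊎-map-injective f-inj g-inj {inj₁ x} {inj₁ y} eq = cong inj₁ (f-inj x y (inj₁-injective eq))
⊎-map-injective f-inj g-inj {inj₂ x} {inj₂ y} eq = cong inj₂ (g-inj x y (inj₂-injective eq))

lookup-ext : ∀ {m} {A : Set} {u v : Vec A m} → (∀ i → lookup u i ≡ lookup v i) → u ≡ v
lookup-ext {u = u} {v} u≗v = trans (sym (tabulate∘lookup u)) (trans (tabulate-cong u≗v) (tabulate∘lookup v))

-- Interleaving

module _ {n : ℕ} where

  record Interleaves (σ : Endo n) (α : Endo ⌈ n /2⌉) (β : Endo ⌊ n /2⌋) : Set where
    constructor interleaving
    field lookup-join : ∀ s → lookup σ (join s) ≡ join (Sum.map (lookup α) (lookup β) s)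
  open Interleaves

  interleave : Endo ⌈ n /2⌉ → Endo ⌊ n /2⌋ → Endo n
  interleave α β = tabulate (λ i → join (Sum.map (lookup α) (lookup β) (split i)))

  -- The default values only matter when σ is not parity alternating.
  restrictEven : Endo n → Endo ⌈ n /2⌉
  restrictEven σ = tabulate (λ j → fromInj₁ (λ _ → j) (split (lookup σ (even j))))

  restrictOdd : Endo n → Endo ⌊ n /2⌋
  restrictOdd σ = tabulate (λ j → fromInj₂ (λ _ → j) (split (lookup σ (odd j))))

  interleave-interleaves : ∀ α β → Interleaves (interleave α β) α β
  interleave-interleaves α β = interleaving λ s →
    trans (lookup∘tabulate _ (join s)) (cong (join ∘ Sum.map (lookup α) (lookup β)) (split-join s))

  restrict-interleaves : ∀ {σ} → IsParityAlternating σ → Interleaves σ (restrictEven σ) (restrictOdd σ)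
  restrict-interleaves {σ} pa = interleaving λ where
    (inj₁ j) → sym (trans (cong even (lookup∘tabulate _ j))
      (even-fromInj₁-split _ (lookup σ (even j)) (trans (pa (even j)) (even-%2 j))))
    (inj₂ j) → sym (trans (cong odd (lookup∘tabulate _ j))
      (odd-fromInj₂-split _ (lookup σ (odd j)) (trans (pa (odd j)) (odd-%2 j))))

  module _ {σ : Endo n} {α : Endo ⌈ n /2⌉} {β : Endo ⌊ n /2⌋} (σ≈αβ : Interleaves σ α β) where

    interleaves-lookup : ∀ i → lookup σ i ≡ join (Sum.map (lookup α) (lookup β) (split i))
    interleaves-lookup i = trans (cong (lookup σ) (sym (join-split i))) (lookup-join σ≈αβ (split i))

    split-lookup : ∀ i → split (lookup σ i) ≡ Sum.map (lookup α) (lookup β) (split i)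
    split-lookup i = trans (cong split (interleaves-lookup i)) (split-join _)

    restrictEven-interleaves : restrictEven σ ≡ α
    restrictEven-interleaves = lookup-ext λ j → begin
      lookup (restrictEven σ) j                       ≡⟨ lookup∘tabulate _ j ⟩
      fromInj₁ (λ _ → j) (split (lookup σ (even j)))  ≡⟨ cong (fromInj₁ (λ _ → j) ∘ split) (lookup-join σ≈αβ (inj₁ j)) ⟩
      fromInj₁ (λ _ → j) (split (even (lookup α j)))  ≡⟨ cong (fromInj₁ (λ _ → j)) (split-join (inj₁ (lookup α j))) ⟩
      lookup α j                                      ∎

    restrictOdd-interleaves : restrictOdd σ ≡ β
    restrictOdd-interleaves = lookup-ext λ j → begin
      lookup (restrictOdd σ) j                        ≡⟨ lookup∘tabulate _ j ⟩
      fromInj₂ (λ _ → j) (split (lookup σ (odd j)))   ≡⟨ cong (fromInj₂ (λ _ → j) ∘ split) (lookup-join σ≈αβ (inj₂ j)) ⟩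
      fromInj₂ (λ _ → j) (split (odd (lookup β j)))   ≡⟨ cong (fromInj₂ (λ _ → j)) (split-join (inj₂ (lookup β j))) ⟩
      lookup β j                                      ∎

    interleaves⇒parityAlternating : IsParityAlternating σ
    interleaves⇒parityAlternating i = begin
      toℕ (lookup σ i) % 2                                         ≡⟨ cong (λ x → toℕ x % 2) (interleaves-lookup i) ⟩
      toℕ (join (Sum.map (lookup α) (lookup β) (split i))) % 2     ≡⟨ same-parity (split i) ⟩
      toℕ (join (split i)) % 2                                     ≡⟨ cong (λ x → toℕ x % 2) (join-split i) ⟩
      toℕ i % 2                                                    ∎
      where
      same-parity : ∀ s → toℕ (join (Sum.map (lookup α) (lookup β) s)) % 2 ≡ toℕ (join s) % 2
      same-parity (inj₁ j) = trans (even-%2 (lookup α j)) (sym (even-%2 j))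
      same-parity (inj₂ j) = trans (odd-%2 (lookup β j)) (sym (odd-%2 j))

  interleaves-unique : ∀ {σ τ α β} → Interleaves σ α β → Interleaves τ α β → σ ≡ τ
  interleaves-unique σ≈αβ τ≈αβ = lookup-ext λ i →
    trans (interleaves-lookup σ≈αβ i) (sym (interleaves-lookup τ≈αβ i))

module _ {n : ℕ} {σ : Endo n} {α : Endo ⌈ n /2⌉} {β : Endo ⌊ n /2⌋} (σ≈αβ : Interleaves σ α β) where
  open Interleaves σ≈αβ

  on-even : ∀ j → lookup σ (even j) ≡ even (lookup α j)
  on-even j = lookup-join (inj₁ j)

  on-odd : ∀ j → lookup σ (odd j) ≡ odd (lookup β j)
  on-odd j = lookup-join (inj₂ j)

  interleaves-isPerm : IsPerm σ ⇔ (IsPerm α × IsPerm β)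
  interleaves-isPerm = mk⇔
    (λ σ-inj → isPerm-restriction σ α even on-even (λ e → inj₁-injective (join-injective e)) σ-inj
             , isPerm-restriction σ β odd on-odd (λ e → inj₂-injective (join-injective e)) σ-inj)
    (λ (α-inj , β-inj) i j σi≡σj → split-injective (⊎-map-injective α-inj β-inj
      (trans (sym (split-lookup σ≈αβ i)) (trans (cong split σi≡σj) (split-lookup σ≈αβ j)))))

  interleaves-isDerangement : IsDerangement σ ⇔ (IsDerangement α × IsDerangement β)
  interleaves-isDerangement = mk⇔
    (λ σ-der → isDerangement-restriction σ α even on-even σ-der , isDerangement-restriction σ β odd on-odd σ-der)
    (λ (α-der , β-der) i σi≡i → no-fixed-point α-der β-der (split i)
      (trans (sym (split-lookup σ≈αβ i)) (cong split σi≡i)))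
    where
    no-fixed-point : IsDerangement α → IsDerangement β → ∀ s → Sum.map (lookup α) (lookup β) s ≢ s
    no-fixed-point α-der β-der (inj₁ j) = α-der j ∘ inj₁-injective
    no-fixed-point α-der β-der (inj₂ j) = β-der j ∘ inj₂-injective

  interleaves-cycles : cycles σ ≡ cycles α + cycles β
  interleaves-cycles = trans (count-allFin-split (isCycleMin? σ)) (cong₂ _+_
    (count-⇔ _ (isCycleMin? α) (isCycleMin-embedding σ α even on-even even-≤) (allFin ⌈ n /2⌉))
    (count-⇔ _ (isCycleMin? β) (isCycleMin-embedding σ β odd on-odd odd-≤) (allFin ⌊ n /2⌋)))

  interleaves-∸cycles : n ∸ cycles σ ≡ (⌊ n /2⌋ ∸ cycles β) + (⌈ n /2⌉ ∸ cycles α)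
  interleaves-∸cycles = begin
    n ∸ cycles σ
      ≡⟨ cong₂ _∸_ (sym (⌊n/2⌋+⌈n/2⌉≡n n)) (trans interleaves-cycles (+-comm (cycles α) (cycles β))) ⟩
    (⌊ n /2⌋ + ⌈ n /2⌉) ∸ (cycles β + cycles α)
      ≡⟨ [m+n]∸[o+p]≡[m∸o]+[n∸p] (cycles≤ β) (cycles≤ α) ⟩
    (⌊ n /2⌋ ∸ cycles β) + (⌈ n /2⌉ ∸ cycles α)
      ∎

  interleaves-isEven : IsEven σ ⇔ ((IsEven β × IsEven α) ⊎ (IsOdd β × IsOdd α))
  interleaves-isEven = subst (λ k → k % 2 ≡ 0 ⇔ ((IsEven β × IsEven α) ⊎ (IsOdd β × IsOdd α)))
    (sym interleaves-∸cycles) (+-%2≡0⇔ (⌊ n /2⌋ ∸ cycles β) (⌈ n /2⌉ ∸ cycles α))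

  interleaves-isOdd : IsOdd σ ⇔ ((IsEven β × IsOdd α) ⊎ (IsOdd β × IsEven α))
  interleaves-isOdd = subst (λ k → k % 2 ≢ 0 ⇔ ((IsEven β × IsOdd α) ⊎ (IsOdd β × IsEven α)))
    (sym interleaves-∸cycles) (+-%2≢0⇔ (⌊ n /2⌋ ∸ cycles β) (⌈ n /2⌉ ∸ cycles α))

-- Counting parity alternating derangements by sign

SignedDerangement : ∀ {m} → (Endo m → Set) → Endo m → Set
SignedDerangement S τ = IsPerm τ × IsDerangement τ × S τ

SignedPAD : ∀ {m} → (Endo m → Set) → Endo m → Set
SignedPAD S σ = IsPerm σ × IsParityAlternating σ × IsDerangement σ × S σ

signedDerangement? : ∀ {m} {S : Endo m → Set} → Decidable S → Decidable (SignedDerangement S)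
signedDerangement? S? τ = isPerm? τ ×-dec isDerangement? τ ×-dec S? τ

signedPAD? : ∀ {m} {S : Endo m → Set} → Decidable S → Decidable (SignedPAD S)
signedPAD? S? σ = isPerm? σ ×-dec isParityAlternating? σ ×-dec isDerangement? σ ×-dec S? σ

module _ {n : ℕ} {σ : Endo n} {α : Endo ⌈ n /2⌉} {β : Endo ⌊ n /2⌋} (σ≈αβ : Interleaves σ α β)
         (S : Endo n → Set) (S₁ : Endo ⌊ n /2⌋ → Set) (S₂ : Endo ⌈ n /2⌉ → Set)
         (S₃ : Endo ⌊ n /2⌋ → Set) (S₄ : Endo ⌈ n /2⌉ → Set) where

  interleaves-signedPAD : S σ ⇔ ((S₁ β × S₂ α) ⊎ (S₃ β × S₄ α)) →
    SignedPAD S σ ⇔ ((SignedDerangement S₁ β × SignedDerangement S₂ α) ⊎ (SignedDerangement S₃ β × SignedDerangement S₄ α))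
  interleaves-signedPAD sign = mk⇔
    (λ (σ-perm , _ , σ-der , s) →
      let α-perm , β-perm = Equivalence.to (interleaves-isPerm σ≈αβ) σ-perm
          α-der , β-der   = Equivalence.to (interleaves-isDerangement σ≈αβ) σ-der
      in Sum.map (λ (s₁ , s₂) → (β-perm , β-der , s₁) , (α-perm , α-der , s₂))
                 (λ (s₃ , s₄) → (β-perm , β-der , s₃) , (α-perm , α-der , s₄))
                 (Equivalence.to sign s))
    [ (λ ((β-perm , β-der , s₁) , (α-perm , α-der , s₂)) → assemble α-perm β-perm α-der β-der (inj₁ (s₁ , s₂)))
    , (λ ((β-perm , β-der , s₃) , (α-perm , α-der , s₄)) → assemble α-perm β-perm α-der β-der (inj₂ (s₃ , s₄))) ]′
    where
    assemble : IsPerm α → IsPerm β → IsDerangement α → IsDerangement β →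
      ((S₁ β × S₂ α) ⊎ (S₃ β × S₄ α)) → SignedPAD S σ
    assemble α-perm β-perm α-der β-der signs =
        Equivalence.from (interleaves-isPerm σ≈αβ) (α-perm , β-perm)
      , interleaves⇒parityAlternating σ≈αβ
      , Equivalence.from (interleaves-isDerangement σ≈αβ) (α-der , β-der)
      , Equivalence.from sign signs

count-via-interleave : ∀ n {P : Endo n → Set} {Q : Endo ⌊ n /2⌋ × Endo ⌈ n /2⌉ → Set}
  (P? : Decidable P) (Q? : Decidable Q) →
  (∀ {σ} → P σ → IsParityAlternating σ) → (∀ {σ α β} → Interleaves σ α β → P σ ⇔ Q (β , α)) →
  count P? (words n n) ≡ count Q? (cartesianProduct (words ⌊ n /2⌋ ⌊ n /2⌋) (words ⌈ n /2⌉ ⌈ n /2⌉))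
count-via-interleave n P? Q? P⇒pa P⇔Q =
  count-bijection P? Q? (words-enumeration n n) (×-enumeration (words-enumeration _ _) (words-enumeration _ _))
    restrict (λ (β , α) → interleave α β)
    (λ p → Equivalence.to (P⇔Q (restrict-interleaves (P⇒pa p))) p)
    (λ {(β , α)} → Equivalence.from (P⇔Q (interleave-interleaves α β)))
    (λ p → interleave-restrict (P⇒pa p))
    (λ {(β , α)} _ → cong₂ _,_ (restrictOdd-interleaves (interleave-interleaves α β))
                               (restrictEven-interleaves (interleave-interleaves α β)))
  where
  restrict : Endo n → Endo ⌊ n /2⌋ × Endo ⌈ n /2⌉
  restrict σ = restrictOdd σ , restrictEven σ
  interleave-restrict : ∀ {σ} → IsParityAlternating σ → interleave (restrictEven σ) (restrictOdd σ) ≡ σ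
  interleave-restrict pa = interleaves-unique (interleave-interleaves _ _) (restrict-interleaves pa)

evenDerangement? : ∀ {m} → Decidable (SignedDerangement {m} IsEven)
evenDerangement? = signedDerangement? isEven?

oddDerangement? : ∀ {m} → Decidable (SignedDerangement {m} IsOdd)
oddDerangement? = signedDerangement? isOdd?

evenPADs-formula : ∀ n → evenPADs n ≡ evenDerangements ⌊ n /2⌋ * evenDerangements ⌈ n /2⌉
                                      + oddDerangements ⌊ n /2⌋ * oddDerangements ⌈ n /2⌉
evenPADs-formula n = trans
  (count-via-interleave n (signedPAD? isEven?)
    (λ p → (evenDerangement? (proj₁ p) ×-dec evenDerangement? (proj₂ p))
        ⊎-dec (oddDerangement? (proj₁ p) ×-dec oddDerangement? (proj₂ p)))
    (proj₁ ∘ proj₂)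
    (λ σ≈αβ → interleaves-signedPAD σ≈αβ IsEven IsEven IsEven IsOdd IsOdd (interleaves-isEven σ≈αβ)))
  (count-⊎-× evenDerangement? oddDerangement? evenDerangement? oddDerangement? (λ (_ , _ , e) (_ , _ , ¬e) → ¬e e)
    (words ⌊ n /2⌋ ⌊ n /2⌋) (words ⌈ n /2⌉ ⌈ n /2⌉))

oddPADs-formula : ∀ n → oddPADs n ≡ evenDerangements ⌊ n /2⌋ * oddDerangements ⌈ n /2⌉
                                    + evenDerangements ⌈ n /2⌉ * oddDerangements ⌊ n /2⌋
oddPADs-formula n = begin
  oddPADs n
    ≡⟨ count-via-interleave n (signedPAD? isOdd?)
         (λ p → (evenDerangement? (proj₁ p) ×-dec oddDerangement? (proj₂ p))
             ⊎-dec (oddDerangement? (proj₁ p) ×-dec evenDerangement? (proj₂ p)))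
         (proj₁ ∘ proj₂)
         (λ σ≈αβ → interleaves-signedPAD σ≈αβ IsOdd IsEven IsOdd IsOdd IsEven (interleaves-isOdd σ≈αβ)) ⟩
  _ ≡⟨ count-⊎-× evenDerangement? oddDerangement? oddDerangement? evenDerangement? (λ (_ , _ , e) (_ , _ , ¬e) → ¬e e)
         (words ⌊ n /2⌋ ⌊ n /2⌋) (words ⌈ n /2⌉ ⌈ n /2⌉) ⟩
  evenDerangements ⌊ n /2⌋ * oddDerangements ⌈ n /2⌉ + oddDerangements ⌊ n /2⌋ * evenDerangements ⌈ n /2⌉
    ≡⟨ cong (evenDerangements ⌊ n /2⌋ * oddDerangements ⌈ n /2⌉ +_) (*-comm (oddDerangements ⌊ n /2⌋) _) ⟩
  evenDerangements ⌊ n /2⌋ * oddDerangements ⌈ n /2⌉ + evenDerangements ⌈ n /2⌉ * oddDerangements ⌊ n /2⌋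
    ∎

proposition3 : (n : ℕ) →
    (evenPADs n ≡ evenDerangements ⌊ n /2⌋ * evenDerangements ⌈ n /2⌉
                  + oddDerangements ⌊ n /2⌋ * oddDerangements ⌈ n /2⌉)
    × (oddPADs n ≡ evenDerangements ⌊ n /2⌋ * oddDerangements ⌈ n /2⌉
                  + evenDerangements ⌈ n /2⌉ * oddDerangements ⌊ n /2⌋)
proposition3 n = evenPADs-formula n , oddPADs-formula n
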